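{- The theta graph $\theta_{2,3,4}$ is not an $i$-graph, i.e. there is no graph $G$ with $\mathcal{I}(G)\cong\theta_{2,3,4}$.
   Context: For a graph $G$, an $i$-set is an independent dominating set of minimum cardinality. The $i$-graph $\mathcal{I}(G)$ has the $i$-sets as vertices, with $X\sim Y$ iff $Y=(X\setminus\{u\})\cup\{v\}$ for some $u\in X$, $v\notin X$ with $uv\in E(G)$. $\theta_{j,k,\ell}$ denotes two vertices joined by three internally vertex-disjoint paths of lengths $j,k,\ell$. -}

module Defs where

open import Data.Nat using (ℕ; _≤_)
open import Data.Fin using (Fin; zero; suc)
open import Data.Fin.Subset using (Subset; _∈_; _∉_; ∣_∣; ⁅_⁆; _∪_; _-_)
open import Data.Product using (Σ; ∃; ∃-syntax; _×_; _,_)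
open import Data.Sum using (_⊎_)
open import Data.Empty using (⊥)
open import Relation.Nullary using (¬_)
open import Relation.Binary.PropositionalEquality using (_≡_)
open import Function.Bundles using (_⇔_)

record SimpleGraph : Set₁ where
  field
    n      : ℕ
    Adj    : Fin n → Fin n → Set
    sym    : ∀ {x y} → Adj x y → Adj y x
    irrefl : ∀ {x} → ¬ Adj x x

module _ (G : SimpleGraph) where
  open SimpleGraph G

  Independent : Subset n → Set
  Independent X = ∀ x y → x ∈ X → y ∈ X → ¬ Adj x y

  Dominating : Subset n → Set
  Dominating X = ∀ v → v ∈ X ⊎ ∃[ u ] (u ∈ X × Adj u v)

  IndepDom : Subset n → Set
  IndepDom X = Independent X × Dominating X

  ISet : Subset n → Set
  ISet X = IndepDom X × (∀ Y → IndepDom Y → ∣ X ∣ ≤ ∣ Y ∣)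

  IAdj : Subset n → Subset n → Set
  IAdj X Y = ∃[ u ] ∃[ v ] (u ∈ X × v ∉ X × Adj u v × Y ≡ (X - u) ∪ ⁅ v ⁆)

-- θ_{2,3,4}: endpoints 0 and 1; paths 0-2-1, 0-3-4-1, 0-5-6-7-1.
data ThetaEdge : Fin 8 → Fin 8 → Set where
  e02 : ThetaEdge zero (suc (suc zero))
  e21 : ThetaEdge (suc (suc zero)) (suc zero)
  e03 : ThetaEdge zero (suc (suc (suc zero)))
  e34 : ThetaEdge (suc (suc (suc zero))) (suc (suc (suc (suc zero))))
  e41 : ThetaEdge (suc (suc (suc (suc zero)))) (suc zero)
  e05 : ThetaEdge zero (suc (suc (suc (suc (suc zero)))))
  e56 : ThetaEdge (suc (suc (suc (suc (suc zero))))) (suc (suc (suc (suc (suc (suc zero))))))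
  e67 : ThetaEdge (suc (suc (suc (suc (suc (suc zero)))))) (suc (suc (suc (suc (suc (suc (suc zero)))))))
  e71 : ThetaEdge (suc (suc (suc (suc (suc (suc (suc zero))))))) (suc zero)

Theta234Adj : Fin 8 → Fin 8 → Set
Theta234Adj a b = ThetaEdge a b ⊎ ThetaEdge b a

IGraphIsoTheta234 : SimpleGraph → Set
IGraphIsoTheta234 G =
  Σ (Fin 8 → Subset (SimpleGraph.n G)) λ f →
      (∀ a → ISet G (f a))
    × (∀ a b → f a ≡ f b → a ≡ b)
    × (∀ X → ISet G X → ∃[ a ] (f a ≡ X))
    × (∀ a b → Theta234Adj a b ⇔ IAdj G (f a) (f b))

-- Only independence and domination of the i-sets matter.  Along an induced path
-- X → Y → Z of the i-graph the second swap can neither move the vertex just added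
-- nor restore the vertex just removed; around an induced 5-cycle this forces the
-- i-th swap to replace x_i by x_{i+2}.  Write Fₐ for the i-set at vertex a of
-- θ_{2,3,4}.  The paths of lengths 2 and 3 form such a 5-cycle, so F₀ and F₁
-- differ by trading {x₀, x₁} for {x₂, x₃}.  The path F₀ F₅ F₆ F₇ F₁ must make
-- this trade with its middle swap, and each of the four possible middle swaps
-- either puts two adjacent vertices into F₆ or makes F₆ adjacent to F₂.
module Submission where

open import Defs
open import Data.Nat using (ℕ)
open import Data.Fin using (Fin; #_)
open import Data.Fin.Properties using (_≟_)
open import Data.Fin.Subset using (Subset; _∈_; _∉_; _⊆_; ⁅_⁆; _∪_; _-_; _─_; outside)
open import Data.Fin.Subset.Properties
  using (x∈p∪q⁻; x∈p∪q⁺; x∈⁅x⁆; x∈⁅y⁆⇒x≡y; x∈p∧x≢y⇒x∈p-y; p─q⊆p; ⊆-antisym)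
open import Data.Vec using (_∷_; here; there)
open import Data.Product using (_×_; _,_; proj₁; proj₂)
open import Data.Sum as Sum using (_⊎_; inj₁; inj₂)
open import Data.Empty using (⊥; ⊥-elim)
open import Relation.Nullary using (¬_; yes; no)
open import Relation.Binary.PropositionalEquality using (_≡_; _≢_; refl; sym; trans; subst; subst₂; ≢-sym)
open import Function using (case_of_)
open import Function.Bundles using (_⇔_; Equivalence)

private
  variable
    n : ℕ
    X Y Z W : Subset n
    u v u′ v′ w w′ : Fin n

x∈p─q⇒x∉q : ∀ (p q : Subset n) → w ∈ p ─ q → w ∉ q
x∈p─q⇒x∉q (_ ∷ p) (outside ∷ q) here ()
x∈p─q⇒x∉q (_ ∷ p) (_ ∷ q) (there w∈p─q) (there w∈q) = x∈p─q⇒x∉q p q w∈p─q w∈q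

x∈p∧y∉p⇒x≢y : w ∈ X → w′ ∉ X → w ≢ w′
x∈p∧y∉p⇒x≢y w∈X w′∉X refl = w′∉X w∈X

∈-swap⁻ : w ∈ (X - u) ∪ ⁅ v ⁆ → w ≡ v ⊎ (w ∈ X × w ≢ u)
∈-swap⁻ {X = X} {u} {v} w∈ with x∈p∪q⁻ (X - u) ⁅ v ⁆ w∈
... | inj₁ w∈X-u = inj₂ (p─q⊆p X ⁅ u ⁆ w∈X-u , λ { refl → x∈p─q⇒x∉q X ⁅ u ⁆ w∈X-u (x∈⁅x⁆ u) })
... | inj₂ w∈⁅v⁆ = inj₁ (x∈⁅y⁆⇒x≡y v w∈⁅v⁆)

∈-swap⁺ : w ∈ X → w ≢ u → w ∈ (X - u) ∪ ⁅ v ⁆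
∈-swap⁺ w∈X w≢u = x∈p∪q⁺ (inj₁ (x∈p∧x≢y⇒x∈p-y w∈X w≢u))

added∈-swap : v ∈ (X - u) ∪ ⁅ v ⁆
added∈-swap {v = v} = x∈p∪q⁺ (inj₂ (x∈⁅x⁆ v))

module _ (G : SimpleGraph) where
  open SimpleGraph G using (Adj; irrefl) renaming (n to N; sym to Adj-sym)

  record Swap (X : Subset N) (u v : Fin N) (Y : Subset N) : Set where
    field
      removed∈ : u ∈ X
      added∉   : v ∉ X
      edge     : Adj u v
      result   : Y ≡ (X - u) ∪ ⁅ v ⁆

    added∈ : v ∈ Y
    added∈ = subst (v ∈_) (sym result) added∈-swap

    kept : w ∈ X → w ≢ u → w ∈ Y
    kept w∈X w≢u = subst (_ ∈_) (sym result) (∈-swap⁺ w∈X w≢u)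

    kept⁻ : w ∈ Y → w ≢ v → w ∈ X
    kept⁻ w∈Y w≢v with ∈-swap⁻ (subst (_ ∈_) result w∈Y)
    ... | inj₁ w≡v        = ⊥-elim (w≢v w≡v)
    ... | inj₂ (w∈X , _) = w∈X

    removed∉ : u ∉ Y
    removed∉ u∈Y with ∈-swap⁻ (subst (_ ∈_) result u∈Y)
    ... | inj₁ refl       = added∉ removed∈
    ... | inj₂ (_ , u≢u) = u≢u refl

    excluded : w ∉ X → w ≢ v → w ∉ Y
    excluded w∉X w≢v w∈Y = w∉X (kept⁻ w∈Y w≢v)

    excluded⁻ : w ∉ Y → w ≢ u → w ∉ X
    excluded⁻ w∉Y w≢u w∈X = w∉Y (kept w∈X w≢u)

    leaving⇒removed : w ∈ X → w ∉ Y → w ≡ u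
    leaving⇒removed {w = w} w∈X w∉Y with w ≟ u
    ... | yes w≡u = w≡u
    ... | no w≢u  = ⊥-elim (w∉Y (kept w∈X w≢u))

  open Swap

  adjacent⇒≢ : Adj u v → u ≢ v
  adjacent⇒≢ uv refl = irrefl uv

  swap⇒IAdj : Swap X u v Y → IAdj G X Y
  swap⇒IAdj {u = u} {v} s = u , v , removed∈ s , added∉ s , edge s , result s

  mkSwap : u ∈ X → v ∉ X → Adj u v → u ∉ Y → v ∈ Y →
           (∀ {w} → w ∈ X → w ≢ u → w ∈ Y) → (∀ {w} → w ∈ Y → w ≢ v → w ∈ X) →
           Swap X u v Y
  mkSwap {u = u} {X} {v} {Y} u∈X v∉X uv u∉Y v∈Y keep keep⁻ = record
    { removed∈ = u∈X ; added∉ = v∉X ; edge = uv ; result = ⊆-antisym Y⊆ ⊆Y }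
    where
    Y⊆ : Y ⊆ (X - u) ∪ ⁅ v ⁆
    Y⊆ {w} w∈Y with w ≟ v
    ... | yes refl = added∈-swap
    ... | no w≢v   = ∈-swap⁺ (keep⁻ w∈Y w≢v) (x∈p∧y∉p⇒x≢y w∈Y u∉Y)
    ⊆Y : (X - u) ∪ ⁅ v ⁆ ⊆ Y
    ⊆Y w∈ with ∈-swap⁻ w∈
    ... | inj₁ refl          = v∈Y
    ... | inj₂ (w∈X , w≢u) = keep w∈X w≢u

  reverse : Swap X u v Y → Swap Y v u X
  reverse s = mkSwap (added∈ s) (removed∉ s) (Adj-sym (edge s)) (added∉ s) (removed∈ s) (kept⁻ s) (kept s)

  swap-swap⁻¹-⊆ : Swap X u v Y → Swap Y v u Z → X ⊆ Z
  swap-swap⁻¹-⊆ {u = u} s₁ s₂ {w} w∈X with w ≟ u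
  ... | yes refl = added∈ s₂
  ... | no w≢u   = kept s₂ (kept s₁ w∈X w≢u) (x∈p∧y∉p⇒x≢y w∈X (added∉ s₁))

  swap-swap⁻¹ : Swap X u v Y → Swap Y v u Z → X ≡ Z
  swap-swap⁻¹ s₁ s₂ = ⊆-antisym (swap-swap⁻¹-⊆ s₁ s₂) (swap-swap⁻¹-⊆ (reverse s₂) (reverse s₁))

  -- The edge u w comes from a vertex of Z dominating u: any other candidate would
  -- already lie in X, next to u.
  swap-shortcut : IndepDom G X → IndepDom G Z → Swap X u v Y → Swap Y v w Z → w ≢ u → Swap X u w Z
  swap-shortcut {X = X} {Z = Z} {u = u} {w = w} (indX , _) (_ , domZ) s₁ s₂ w≢u =
    mkSwap (removed∈ s₁) w∉X uw u∉Z (added∈ s₂) keep keep⁻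
    where
    w∉X : w ∉ X
    w∉X = excluded⁻ s₁ (added∉ s₂) w≢u
    u∉Z : u ∉ Z
    u∉Z = excluded s₂ (removed∉ s₁) (≢-sym w≢u)
    keep : ∀ {x} → x ∈ X → x ≢ u → x ∈ Z
    keep x∈X x≢u = kept s₂ (kept s₁ x∈X x≢u) (x∈p∧y∉p⇒x≢y x∈X (added∉ s₁))
    keep⁻ : ∀ {x} → x ∈ Z → x ≢ w → x ∈ X
    keep⁻ x∈Z x≢w = kept⁻ s₁ (kept⁻ s₂ x∈Z x≢w) (x∈p∧y∉p⇒x≢y x∈Z (removed∉ s₂))
    uw : Adj u w
    uw with domZ u
    ... | inj₁ u∈Z = ⊥-elim (u∉Z u∈Z)
    ... | inj₂ (z , z∈Z , zu) with z ≟ w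
    ...   | yes refl = Adj-sym zu
    ...   | no z≢w   = ⊥-elim (indX z u (keep⁻ z∈Z z≢w) (removed∈ s₁) zu)

  Nonadjacent : Subset N → Subset N → Set
  Nonadjacent X Z = X ≢ Z × ¬ IAdj G X Z

  removed≢added : IndepDom G X → IndepDom G Z → Nonadjacent X Z →
                  Swap X u v Y → Swap Y u′ v′ Z → u′ ≢ v
  removed≢added {u = u} {v′ = v′} indDomX indDomZ (X≢Z , ¬XZ) s₁ s₂ refl with v′ ≟ u
  ... | yes refl  = X≢Z (swap-swap⁻¹ s₁ s₂)
  ... | no v′≢u = ¬XZ (swap⇒IAdj (swap-shortcut indDomX indDomZ s₁ s₂ v′≢u))

  added≢removed : IndepDom G X → IndepDom G Z → Nonadjacent X Z →
                  Swap X u v Y → Swap Y u′ v′ Z → v′ ≢ u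
  added≢removed {v = v} indDomX indDomZ@(indZ , _) XZ s₁ s₂ refl =
    indZ _ v (added∈ s₂) (kept s₂ (added∈ s₁) (≢-sym (removed≢added indDomX indDomZ XZ s₁ s₂))) (edge s₁)

  record Move (X Y : Subset N) : Set where
    field
      removed added : Fin N
      swap          : Swap X removed added Y

  open Move

  record InducedPentagon (X₀ X₁ X₂ X₃ X₄ : Subset N) : Set where
    field
      step₀ : Move X₀ X₁
      step₁ : Move X₁ X₂
      step₂ : Move X₂ X₃
      step₃ : Move X₃ X₄
      step₄ : Move X₄ X₀
      indepDom₀ : IndepDom G X₀
      indepDom₁ : IndepDom G X₁
      indepDom₂ : IndepDom G X₂
      indepDom₃ : IndepDom G X₃
      indepDom₄ : IndepDom G X₄
      nonadj₀ : Nonadjacent X₀ X₂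
      nonadj₁ : Nonadjacent X₁ X₃
      nonadj₂ : Nonadjacent X₂ X₄
      nonadj₃ : Nonadjacent X₃ X₀
      nonadj₄ : Nonadjacent X₄ X₁

  rotate : ∀ {X₀ X₁ X₂ X₃ X₄} → InducedPentagon X₀ X₁ X₂ X₃ X₄ → InducedPentagon X₁ X₂ X₃ X₄ X₀
  rotate P = record
    { step₀ = step₁ ; step₁ = step₂ ; step₂ = step₃ ; step₃ = step₄ ; step₄ = step₀
    ; indepDom₀ = indepDom₁ ; indepDom₁ = indepDom₂ ; indepDom₂ = indepDom₃
    ; indepDom₃ = indepDom₄ ; indepDom₄ = indepDom₀
    ; nonadj₀ = nonadj₁ ; nonadj₁ = nonadj₂ ; nonadj₂ = nonadj₃ ; nonadj₃ = nonadj₄ ; nonadj₄ = nonadj₀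
    }
    where open InducedPentagon P

  open InducedPentagon

  -- The vertex added by step₀ survives step₁ and step₄; if it also survived
  -- step₂ and step₃ it would return to X₀.
  added₀≡removed₂⊎removed₃ : ∀ {X₀ X₁ X₂ X₃ X₄} (P : InducedPentagon X₀ X₁ X₂ X₃ X₄) →
    added (step₀ P) ≡ removed (step₂ P) ⊎ added (step₀ P) ≡ removed (step₃ P)
  added₀≡removed₂⊎removed₃ {X₀ = X₀} {X₂ = X₂} P
    with added (step₀ P) ≟ removed (step₂ P) | added (step₀ P) ≟ removed (step₃ P)
  ... | yes v≡u₂ | _        = inj₁ v≡u₂
  ... | no _     | yes v≡u₃ = inj₂ v≡u₃
  ... | no v≢u₂  | no v≢u₃  = ⊥-elim (added∉ (swap (step₀ P)) v∈X₀)
    where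
    v∈X₂ : added (step₀ P) ∈ X₂
    v∈X₂ = kept (swap (step₁ P)) (added∈ (swap (step₀ P)))
             (≢-sym (removed≢added (indepDom₀ P) (indepDom₂ P) (nonadj₀ P) (swap (step₀ P)) (swap (step₁ P))))
    v∈X₀ : added (step₀ P) ∈ X₀
    v∈X₀ = kept (swap (step₄ P)) (kept (swap (step₃ P)) (kept (swap (step₂ P)) v∈X₂ v≢u₂) v≢u₃)
             (added≢removed (indepDom₄ P) (indepDom₁ P) (nonadj₄ P) (swap (step₄ P)) (swap (step₀ P)))

  -- Failing that, added step₀ ≡ removed step₃, and the rotated instances force
  -- added step₂ ≡ removed step₀: then X₃ contains both ends of the edge of step₀.
  added₀≡removed₂ : ∀ {X₀ X₁ X₂ X₃ X₄} (P : InducedPentagon X₀ X₁ X₂ X₃ X₄) →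
                    added (step₀ P) ≡ removed (step₂ P)
  added₀≡removed₂ P = resolve (added₀≡removed₂⊎removed₃ P) (added₀≡removed₂⊎removed₃ (rotate P))
                              (added₀≡removed₂⊎removed₃ (rotate (rotate P)))
    where
    resolve : added (step₀ P) ≡ removed (step₂ P) ⊎ added (step₀ P) ≡ removed (step₃ P) →
              added (step₁ P) ≡ removed (step₃ P) ⊎ added (step₁ P) ≡ removed (step₄ P) →
              added (step₂ P) ≡ removed (step₄ P) ⊎ added (step₂ P) ≡ removed (step₀ P) →
              added (step₀ P) ≡ removed (step₂ P)
    resolve (inj₁ v₀≡u₂) _ _ = v₀≡u₂
    resolve (inj₂ v₀≡u₃) (inj₁ v₁≡u₃) _ =
      ⊥-elim (x∈p∧y∉p⇒x≢y (added∈ (swap (step₀ P))) (added∉ (swap (step₁ P))) (trans v₀≡u₃ (sym v₁≡u₃)))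
    resolve (inj₂ _) (inj₂ v₁≡u₄) (inj₁ v₂≡u₄) =
      ⊥-elim (x∈p∧y∉p⇒x≢y (added∈ (swap (step₁ P))) (added∉ (swap (step₂ P))) (trans v₁≡u₄ (sym v₂≡u₄)))
    resolve (inj₂ v₀≡u₃) (inj₂ _) (inj₂ v₂≡u₀) =
      ⊥-elim (proj₁ (indepDom₃ P) _ _ (added∈ (swap (step₂ P))) (removed∈ (swap (step₃ P)))
                (subst₂ Adj (sym v₂≡u₀) v₀≡u₃ (edge (swap (step₀ P)))))

  record Pentagram (X₀ X₁ X₂ X₃ X₄ : Subset N) : Set where
    field
      x₀ x₁ x₂ x₃ x₄ : Fin N
      swap₀ : Swap X₀ x₀ x₂ X₁
      swap₁ : Swap X₁ x₁ x₃ X₂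
      swap₂ : Swap X₂ x₂ x₄ X₃
      swap₃ : Swap X₃ x₃ x₀ X₄
      swap₄ : Swap X₄ x₄ x₁ X₀

  pentagram : ∀ {X₀ X₁ X₂ X₃ X₄} → InducedPentagon X₀ X₁ X₂ X₃ X₄ → Pentagram X₀ X₁ X₂ X₃ X₄
  pentagram P = record
    { swap₀ = subst (λ y → Swap _ _ y _) (added₀≡removed₂ P) (swap (step₀ P))
    ; swap₁ = subst (λ y → Swap _ _ y _) (added₀≡removed₂ (rotate P)) (swap (step₁ P))
    ; swap₂ = subst (λ y → Swap _ _ y _) (added₀≡removed₂ (rotate (rotate P))) (swap (step₂ P))
    ; swap₃ = subst (λ y → Swap _ _ y _) (added₀≡removed₂ (rotate (rotate (rotate P)))) (swap (step₃ P))
    ; swap₄ = subst (λ y → Swap _ _ y _) (added₀≡removed₂ (rotate (rotate (rotate (rotate P)))))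
                    (swap (step₄ P))
    }

  swaps-commute : Swap X u v Y → Swap Y u′ v′ Z → Swap X u′ v′ W → Swap W u v Z
  swaps-commute {u = u} {v = v} {v′ = v′} {Z = Z} {W = W} s₁ s₂ t =
    mkSwap u∈W v∉W (edge s₁) u∉Z v∈Z keep keep⁻
    where
    u∈W : u ∈ W
    u∈W = kept t (removed∈ s₁) (≢-sym (x∈p∧y∉p⇒x≢y (removed∈ s₂) (removed∉ s₁)))
    v∉W : v ∉ W
    v∉W = excluded t (added∉ s₁) (x∈p∧y∉p⇒x≢y (added∈ s₁) (added∉ s₂))
    u∉Z : u ∉ Z
    u∉Z = excluded s₂ (removed∉ s₁) (x∈p∧y∉p⇒x≢y (removed∈ s₁) (added∉ t))
    v∈Z : v ∈ Z
    v∈Z = kept s₂ (added∈ s₁) (≢-sym (x∈p∧y∉p⇒x≢y (removed∈ t) (added∉ s₁)))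
    keep : ∀ {x} → x ∈ W → x ≢ u → x ∈ Z
    keep {x} x∈W x≢u with x ≟ v′
    ... | yes refl = added∈ s₂
    ... | no x≢v′ = kept s₂ (kept s₁ (kept⁻ t x∈W x≢v′) x≢u) (x∈p∧y∉p⇒x≢y x∈W (removed∉ t))
    keep⁻ : ∀ {x} → x ∈ Z → x ≢ v → x ∈ W
    keep⁻ {x} x∈Z x≢v with x ≟ v′
    ... | yes refl = added∈ t
    ... | no x≢v′ = kept t (kept⁻ s₁ (kept⁻ s₂ x∈Z x≢v′) x≢v) (x∈p∧y∉p⇒x≢y x∈Z (removed∉ s₂))

  two-swaps-remove : Swap X u v Y → Swap Y u′ v′ Z → w ∈ X → w ∉ Z → w′ ∈ X → w′ ∉ Z → w ≢ w′ →
                     (u ≡ w × u′ ≡ w′) ⊎ (u ≡ w′ × u′ ≡ w)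
  two-swaps-remove {u = u} {w = w} {w′ = w′} s₁ s₂ w∈X w∉Z w′∈X w′∉Z w≢w′ with u ≟ w | u ≟ w′
  ... | yes refl | _ = inj₁ (refl , sym (leaving⇒removed s₂ (kept s₁ w′∈X (≢-sym w≢w′)) w′∉Z))
  ... | no u≢w | yes refl = inj₂ (refl , sym (leaving⇒removed s₂ (kept s₁ w∈X (≢-sym u≢w)) w∉Z))
  ... | no u≢w | no u≢w′ = ⊥-elim (w≢w′ (trans (leaving⇒removed s₂ (kept s₁ w∈X (≢-sym u≢w)) w∉Z)
                                           (sym (leaving⇒removed s₂ (kept s₁ w′∈X (≢-sym u≢w′)) w′∉Z))))

module Theta234 (G : SimpleGraph) (iso : IGraphIsoTheta234 G) where
  open SimpleGraph G using (Adj) renaming (n to N)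
  open Swap
  open Move

  F : Fin 8 → Subset N
  F = proj₁ iso

  indepDom : ∀ a → IndepDom G (F a)
  indepDom a = proj₁ (proj₁ (proj₂ iso) a)

  independent : ∀ a {x y} → x ∈ F a → y ∈ F a → ¬ Adj x y
  independent a = proj₁ (indepDom a) _ _

  θ⇔IAdj : ∀ a b → Theta234Adj a b ⇔ IAdj G (F a) (F b)
  θ⇔IAdj = proj₂ (proj₂ (proj₂ (proj₂ iso)))

  move : ∀ {a b} → Theta234Adj a b → Move G (F a) (F b)
  move {a} {b} ab with Equivalence.to (θ⇔IAdj a b) ab
  ... | _ , _ , u∈ , v∉ , uv , eq =
    record { swap = record { removed∈ = u∈ ; added∉ = v∉ ; edge = uv ; result = eq } }

  θ-adjacent : ∀ {a b} → Swap G (F a) u v (F b) → Theta234Adj a b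
  θ-adjacent {a = a} {b} s = Equivalence.from (θ⇔IAdj a b) (swap⇒IAdj G s)

  nonadjacent : ∀ {a c} → a ≢ c → ¬ Theta234Adj a c → Nonadjacent G (F a) (F c)
  nonadjacent {a} {c} a≢c ¬ac =
    (λ e → a≢c (proj₁ (proj₂ (proj₂ iso)) a c e)) , λ ac → ¬ac (Equivalence.from (θ⇔IAdj a c) ac)

  path-removed≢added : ∀ {a b c} → a ≢ c → ¬ Theta234Adj a c →
                       Swap G (F a) u v (F b) → Swap G (F b) u′ v′ (F c) → u′ ≢ v
  path-removed≢added a≢c ¬ac = removed≢added G (indepDom _) (indepDom _) (nonadjacent a≢c ¬ac)

  path-added≢removed : ∀ {a b c} → a ≢ c → ¬ Theta234Adj a c →
                       Swap G (F a) u v (F b) → Swap G (F b) u′ v′ (F c) → v′ ≢ u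
  path-added≢removed a≢c ¬ac = added≢removed G (indepDom _) (indepDom _) (nonadjacent a≢c ¬ac)

  pentagon : InducedPentagon G (F (# 0)) (F (# 2)) (F (# 1)) (F (# 4)) (F (# 3))
  pentagon = record
    { step₀ = move (inj₁ e02) ; step₁ = move (inj₁ e21) ; step₂ = move (inj₂ e41)
    ; step₃ = move (inj₂ e34) ; step₄ = move (inj₂ e03)
    ; indepDom₀ = indepDom _ ; indepDom₁ = indepDom _ ; indepDom₂ = indepDom _
    ; indepDom₃ = indepDom _ ; indepDom₄ = indepDom _
    ; nonadj₀ = nonadjacent (λ ()) λ { (inj₁ ()) ; (inj₂ ()) }
    ; nonadj₁ = nonadjacent (λ ()) λ { (inj₁ ()) ; (inj₂ ()) }
    ; nonadj₂ = nonadjacent (λ ()) λ { (inj₁ ()) ; (inj₂ ()) }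
    ; nonadj₃ = nonadjacent (λ ()) λ { (inj₁ ()) ; (inj₂ ()) }
    ; nonadj₄ = nonadjacent (λ ()) λ { (inj₁ ()) ; (inj₂ ()) }
    }

  open Pentagram (pentagram G pentagon)

  open Move (move {# 0} {# 5} (inj₁ e05)) using () renaming (swap to s₀₅)
  open Move (move {# 1} {# 7} (inj₂ e71)) using () renaming (swap to s₁₇)

  x₀∈F₀ : x₀ ∈ F (# 0)
  x₀∈F₀ = removed∈ swap₀
  x₁∈F₀ : x₁ ∈ F (# 0)
  x₁∈F₀ = added∈ swap₄
  x₂∉F₀ : x₂ ∉ F (# 0)
  x₂∉F₀ = added∉ swap₀
  x₃∉F₀ : x₃ ∉ F (# 0)
  x₃∉F₀ = excluded⁻ swap₀ (added∉ swap₁) (adjacent⇒≢ G (edge swap₃))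

  x₀∈F₅ : x₀ ∈ F (# 5)
  x₀∈F₅ = kept s₀₅ x₀∈F₀ (path-removed≢added (λ ()) (λ { (inj₁ ()) ; (inj₂ ()) })
                           (reverse G s₀₅) swap₀)
  x₁∈F₅ : x₁ ∈ F (# 5)
  x₁∈F₅ = kept s₀₅ x₁∈F₀ (path-removed≢added (λ ()) (λ { (inj₁ ()) ; (inj₂ ()) })
                           (reverse G s₀₅) (reverse G swap₄))
  x₂∉F₅ : x₂ ∉ F (# 5)
  x₂∉F₅ = excluded s₀₅ x₂∉F₀ (path-added≢removed (λ ()) (λ { (inj₁ ()) ; (inj₂ ()) })
                           (reverse G s₀₅) swap₀)
  x₃∉F₅ : x₃ ∉ F (# 5)
  x₃∉F₅ = excluded s₀₅ x₃∉F₀ λ x₃≡v →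
    independent (# 5) x₁∈F₅ (subst (_∈ F (# 5)) (sym x₃≡v) (added∈ s₀₅)) (edge swap₁)

  x₂∈F₁ : x₂ ∈ F (# 1)
  x₂∈F₁ = removed∈ swap₂
  x₃∈F₁ : x₃ ∈ F (# 1)
  x₃∈F₁ = added∈ swap₁
  x₁∉F₁ : x₁ ∉ F (# 1)
  x₁∉F₁ = removed∉ swap₁
  x₀∉F₁ : x₀ ∉ F (# 1)
  x₀∉F₁ = excluded swap₁ (removed∉ swap₀) (≢-sym (adjacent⇒≢ G (edge swap₃)))

  x₂∈F₇ : x₂ ∈ F (# 7)
  x₂∈F₇ = kept s₁₇ x₂∈F₁ (path-removed≢added (λ ()) (λ { (inj₁ ()) ; (inj₂ ()) })
                           (reverse G s₁₇) swap₂)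
  x₃∈F₇ : x₃ ∈ F (# 7)
  x₃∈F₇ = kept s₁₇ x₃∈F₁ (path-removed≢added (λ ()) (λ { (inj₁ ()) ; (inj₂ ()) })
                           (reverse G s₁₇) (reverse G swap₁))
  x₁∉F₇ : x₁ ∉ F (# 7)
  x₁∉F₇ = excluded s₁₇ x₁∉F₁ (path-added≢removed (λ ()) (λ { (inj₁ ()) ; (inj₂ ()) })
                           (reverse G s₁₇) (reverse G swap₁))
  x₀∉F₇ : x₀ ∉ F (# 7)
  x₀∉F₇ = excluded s₁₇ x₀∉F₁ λ x₀≡v →
    independent (# 7) (subst (_∈ F (# 7)) (sym x₀≡v) (added∈ s₁₇)) x₂∈F₇ (edge swap₀)

  x₀≢x₁ : x₀ ≢ x₁
  x₀≢x₁ = ≢-sym (x∈p∧y∉p⇒x≢y (removed∈ swap₁) (removed∉ swap₀))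
  x₂≢x₃ : x₂ ≢ x₃
  x₂≢x₃ = x∈p∧y∉p⇒x≢y (added∈ swap₀) (added∉ swap₁)

  middle-removes : Swap G (F (# 5)) u v (F (# 6)) → Swap G (F (# 6)) u′ v′ (F (# 7)) → u ≡ x₀ ⊎ u ≡ x₁
  middle-removes s t = Sum.map proj₁ proj₁ (two-swaps-remove G s t x₀∈F₅ x₀∉F₇ x₁∈F₅ x₁∉F₇ x₀≢x₁)

  middle-adds : Swap G (F (# 5)) u v (F (# 6)) → Swap G (F (# 6)) u′ v′ (F (# 7)) → v ≡ x₃ ⊎ v ≡ x₂
  middle-adds s t =
    Sum.map proj₂ proj₂ (two-swaps-remove G (reverse G t) (reverse G s) x₂∈F₇ x₂∉F₅ x₃∈F₇ x₃∉F₅ x₂≢x₃)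

  middle-swap-impossible : Swap G (F (# 5)) u v (F (# 6)) → u ≡ x₀ ⊎ u ≡ x₁ → v ≡ x₃ ⊎ v ≡ x₂ → ⊥
  middle-swap-impossible s (inj₁ refl) (inj₁ refl) =
    independent (# 6) (kept s x₁∈F₅ (≢-sym x₀≢x₁)) (added∈ s) (edge swap₁)
  -- The swap x₀ ↦ x₂ out of F₀ commutes with the swap F₀ → F₅, so F₆ would be adjacent to F₂.
  middle-swap-impossible s (inj₁ refl) (inj₂ refl) =
    case θ-adjacent (swaps-commute G s₀₅ s swap₀) of λ { (inj₁ ()) ; (inj₂ ()) }
  middle-swap-impossible s (inj₂ refl) (inj₁ refl) =
    independent (# 6) (added∈ s) (kept s x₀∈F₅ x₀≢x₁) (edge swap₃)
  middle-swap-impossible s (inj₂ refl) (inj₂ refl) =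
    independent (# 6) (kept s x₀∈F₅ x₀≢x₁) (added∈ s) (edge swap₀)

mainTheorem8 : (G : SimpleGraph) → ¬ IGraphIsoTheta234 G
mainTheorem8 G iso = middle-swap-impossible s₅₆ (middle-removes s₅₆ s₆₇) (middle-adds s₅₆ s₆₇)
  where
  open Theta234 G iso
  open Move (move {# 5} {# 6} (inj₁ e56)) using () renaming (swap to s₅₆)
  open Move (move {# 6} {# 7} (inj₁ e67)) using () renaming (swap to s₆₇)
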